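{- Let $r>0$ be an integer and let $(T,m)$ be a marked tree (a tree $T$ with a function $m\colon V(T)\to\{0,1\}$) having at least $2r$ marked vertices. Then for every vertex $v \in V(T)$, $(T,m)$ has an $r$-good partition of root $v$.
   Context: A vertex $u$ of a marked tree $(T,m)$ is marked if $m(u)=1$; $\mu(T,m)$ denotes the number of marked vertices. An $r$-good partition of root $v$ of $(T,m)$ is a pair $((T_1,m_1),(T_2,m_2))$ of marked trees such that: (i) $T_1$ and $T_2$ are subtrees of $T$ and $(E(T_1),E(T_2))$ is a partition of $E(T)$; (ii) $r \le \mu(T_1,m_1) \le 2r$; (iii) $v \in V(T_2)$; (iv) every vertex marked in $(T,m)$ is marked in exactly one of $(T_1,m_1)$, $(T_2,m_2)$: precisely, for every $u \in V(T)$, if $u \in V(T_1)\cap V(T_2)$ then $m(u)=1$ if and only if exactly one of $m_1(u)=1$, $m_2(u)=1$ holds, and otherwise, for the unique $i\in\{1,2\}$ with $u \in V(T_i)$, $m(u)=m_i(u)$. -}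

module Defs where

open import Data.Nat using (ℕ; zero; suc; _+_; _*_; _≤_)
open import Data.Fin using (Fin)
import Data.Fin as Fin
open import Data.Bool using (Bool; true; false; _∧_; _xor_; if_then_else_)
open import Data.List using (List; []; _∷_; _++_; [_]; length)
open import Data.List.Relation.Unary.Unique.Propositional using (Unique)
open import Data.Product using (Σ; ∃; _×_; _,_)
open import Data.Sum using (_⊎_)
open import Data.Unit using (⊤)
open import Relation.Binary.PropositionalEquality using (_≡_)
open import Relation.Nullary using (¬_)

-- A (simple, undirected) graph whose vertex set is a subset of Fin n.
-- V u = true : u is a vertex;  E u w = true : {u,w} is an edge.
record Graph (n : ℕ) : Set where
  field
    V    : Fin n → Bool
    E    : Fin n → Fin n → Bool
    Esym : ∀ u w → E u w ≡ E w u
    Eirr : ∀ u → E u u ≡ false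
    EV   : ∀ u w → E u w ≡ true → V u ≡ true

open Graph public

data Walk {n : ℕ} (G : Graph n) : Fin n → Fin n → Set where
  here : ∀ {u} → V G u ≡ true → Walk G u u
  step : ∀ {u w x} → E G u w ≡ true → Walk G w x → Walk G u x

Chain : {n : ℕ} → Graph n → List (Fin n) → Set
Chain G []           = ⊤
Chain G (x ∷ [])     = ⊤
Chain G (x ∷ y ∷ xs) = (E G x y ≡ true) × Chain G (y ∷ xs)

HasCycle : {n : ℕ} → Graph n → Set
HasCycle G = Σ _ λ x → Σ _ λ xs →
  Unique (x ∷ xs) × (2 ≤ length xs) × Chain G (x ∷ xs ++ [ x ])

IsTree : {n : ℕ} → Graph n → Set
IsTree G =
  (∃ λ u → V G u ≡ true) ×
  (∀ u w → V G u ≡ true → V G w ≡ true → Walk G u w) ×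
  ¬ HasCycle G

_⊆G_ : {n : ℕ} → Graph n → Graph n → Set
H ⊆G G = (∀ u → V H u ≡ true → V G u ≡ true) ×
         (∀ u w → E H u w ≡ true → E G u w ≡ true)

IsSubtree : {n : ℕ} → Graph n → Graph n → Set
IsSubtree H G = IsTree H × (H ⊆G G)

count : {n : ℕ} → (Fin n → Bool) → ℕ
count {zero}  f = 0
count {suc n} f = (if f Fin.zero then 1 else 0) + count (λ u → f (Fin.suc u))

μ : {n : ℕ} → Graph n → (Fin n → Bool) → ℕ
μ G m = count (λ u → V G u ∧ m u)

-- r-good partition of root v of the marked tree (T,m).
-- Markings m₁, m₂ are total functions; only their values on V(Tᵢ) matter.
record GoodPartition {n : ℕ} (T : Graph n) (m : Fin n → Bool) (r : ℕ) (v : Fin n) : Set where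
  field
    T₁ T₂ : Graph n
    m₁ m₂ : Fin n → Bool
    sub₁  : IsSubtree T₁ T
    sub₂  : IsSubtree T₂ T
    edges : ∀ u w → E T u w ≡ true →
              (E T₁ u w ≡ true × E T₂ u w ≡ false) ⊎ (E T₁ u w ≡ false × E T₂ u w ≡ true)
    lower : r ≤ μ T₁ m₁
    upper : μ T₁ m₁ ≤ 2 * r
    root  : V T₂ v ≡ true
    cover : ∀ u → V T u ≡ true → (V T₁ u ≡ true ⊎ V T₂ u ≡ true)
    both  : ∀ u → V T₁ u ≡ true → V T₂ u ≡ true → m u ≡ (m₁ u xor m₂ u)
    only₁ : ∀ u → V T₁ u ≡ true → V T₂ u ≡ false → m u ≡ m₁ u
    only₂ : ∀ u → V T₁ u ≡ false → V T₂ u ≡ true → m u ≡ m₂ u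

module Submission where

-- Call a vertex set B a branch at w if w ∉ B, the root v ∉ B, and every edge
-- leaving B ends at w.  For such a branch, the subtrees induced on B ∪ {w} and
-- on the complement of B split the edges of T and meet only in w; unmarking w
-- in the first one, it carries exactly the marks of B.  So it suffices to find
-- a branch whose weight (number of marked vertices) lies between r and 2r.
--
-- The descent starts from the branch V(T) ∖ {v} at v, whose weight is at least
-- 2r − 1, hence at least r.  If a branch B at w weighs more than 2r, a marked
-- vertex of B has a walk to v that leaves B through a neighbour c of w.  With S
-- the component of c inside B, the sets S ∖ {c} (a branch at c) and B ∖ S (a
-- branch at w) have fewer vertices than B and together carry at least 2r marks,
-- so one of them still weighs at least r.  The descent therefore ends with a
-- branch of weight between r and 2r.

open import Defs
open import Data.Nat using (ℕ; zero; suc; _+_; _*_; _<_; _≤_; z≤n; s≤s; _≤?_)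
open import Data.Nat.Properties
  using (≤-trans; ≤-reflexive; <-≤-trans; ≤-pred; n<1+n; m≤n⇒m≤1+n;
         +-identityʳ; +-suc; +-mono-≤; +-mono-<; +-monoˡ-≤; +-cancelˡ-≤; <⇒≱; ≰⇒>;
         module ≤-Reasoning)
open import Data.Fin using (Fin; _≟_) renaming (zero to fzero; suc to fsuc)
open import Data.Fin.Properties using (suc-injective; 0≢1+n; any?)
open import Data.Bool using (Bool; true; false; _∧_; _∨_; not; _xor_; if_then_else_)
open import Data.Bool.Properties
  using (∧-conicalˡ; ∧-conicalʳ; ∨-conicalˡ; ∧-comm; ∧-zeroʳ; ∧-identityʳ)
  renaming (_≟_ to _≟ᵇ_)
open import Data.List using (List; []; _∷_; _++_; [_]; length)
open import Data.List.Relation.Unary.All as All using (All; []; _∷_)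
open import Data.List.Relation.Unary.AllPairs using ([]; _∷_)
open import Data.List.Relation.Unary.Unique.Propositional using (Unique)
open import Data.Product using (Σ; ∃; _×_; _,_; proj₁; proj₂)
open import Data.Sum using (_⊎_; inj₁; inj₂)
import Data.Sum as Sum
open import Data.Unit using (tt)
open import Data.Empty using (⊥; ⊥-elim)
open import Relation.Binary.PropositionalEquality
  using (_≡_; _≢_; refl; sym; trans; cong; cong₂; subst)
open import Relation.Nullary using (¬_; Dec; yes; no; does)
open import Relation.Nullary.Decidable using (dec-true; dec-false; _×-dec_)

true≢false : true ≢ false
true≢false ()

bool-cases : ∀ b → b ≡ true ⊎ b ≡ false
bool-cases true  = inj₁ refl
bool-cases false = inj₂ refl

∧-true : ∀ {a b} → a ≡ true → b ≡ true → a ∧ b ≡ true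
∧-true refl refl = refl

∨-introʳ : ∀ a {b} → b ≡ true → a ∨ b ≡ true
∨-introʳ true  _ = refl
∨-introʳ false p = p

∨-elim : ∀ a {b} → a ∨ b ≡ true → a ≡ true ⊎ b ≡ true
∨-elim true  _ = inj₁ refl
∨-elim false p = inj₂ p

∨-false : ∀ {a b} → a ≡ false → b ≡ false → a ∨ b ≡ false
∨-false refl refl = refl

not-true : ∀ {a} → not a ≡ true → a ≡ false
not-true {false} _ = refl

not-false : ∀ {a} → not a ≡ false → a ≡ true
not-false {true} _ = refl

∧-swapʳ : ∀ a b c → (a ∧ b) ∧ c ≡ (a ∧ c) ∧ b
∧-swapʳ true  true  c = ∧-comm true c
∧-swapʳ true  false c = sym (∧-zeroʳ c)
∧-swapʳ false b     c = refl

∧-absorb : ∀ a b → (b ≡ true → a ≡ true) → a ∧ b ≡ b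
∧-absorb a false _ = ∧-zeroʳ a
∧-absorb a true  h rewrite h refl = refl

-- The marks of B ∪ {w} with w unmarked are the marks of B, when w ∉ B.
∪-unmark : ∀ b e x → (e ≡ true → b ≡ false) → (b ∨ e) ∧ (x ∧ not e) ≡ b ∧ x
∪-unmark true  true  x h = ⊥-elim (true≢false (h refl))
∪-unmark false true  x h = ∧-zeroʳ x
∪-unmark true  false x h = ∧-identityʳ x
∪-unmark false false x h = refl

-- A vertex kept in both sides: its mark survives in exactly one of them.
mark-split : ∀ x {e} → e ≡ true → x ≡ (x ∧ not e) xor x
mark-split true  refl = refl
mark-split false refl = refl

-- A vertex kept in one side only keeps its mark.
mark-kept : ∀ x {e} → e ≡ false → x ≡ x ∧ not e
mark-kept true  refl = refl
mark-kept false refl = refl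

-- Vertex sets of a graph on Fin n, as Boolean functions

Subset : ℕ → Set
Subset n = Fin n → Bool

module _ {n : ℕ} where

  infix  4 _∈_ _∉_ _⊆_
  infixl 6 _∩_ _∖_
  infixl 5 _∪_

  _∈_ _∉_ : Fin n → Subset n → Set
  u ∈ S = S u ≡ true
  u ∉ S = S u ≡ false

  _⊆_ : Subset n → Subset n → Set
  S ⊆ P = ∀ u → u ∈ S → u ∈ P

  _∩_ _∪_ _∖_ : Subset n → Subset n → Subset n
  (S ∩ P) u = S u ∧ P u
  (S ∪ P) u = S u ∨ P u
  (S ∖ P) u = S u ∧ not (P u)

  ∁ : Subset n → Subset n
  ∁ S u = not (S u)

  ⁅_⁆ : Fin n → Subset n
  ⁅ c ⁆ u = does (u ≟ c)

  ∈-or-∉ : ∀ S u → u ∈ S ⊎ u ∉ S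
  ∈-or-∉ S u = bool-cases (S u)

  ∈∉ : ∀ {S u} → u ∈ S → u ∉ S → ⊥
  ∈∉ p q = true≢false (trans (sym p) q)

  ∉-distinct : ∀ {S w z} → w ∉ S → z ∈ S → w ≢ z
  ∉-distinct {S} w∉S z∈S refl = ∈∉ {S} z∈S w∉S

  ∉-⊆ : ∀ {S P u} → S ⊆ P → u ∉ P → u ∉ S
  ∉-⊆ {S} {P} {u} S⊆P u∉P with ∈-or-∉ S u
  ... | inj₁ u∈S = ⊥-elim (∈∉ {P} (S⊆P u u∈S) u∉P)
  ... | inj₂ u∉S = u∉S

  ∈⁅⁆ : ∀ {u c} → u ≡ c → u ∈ ⁅ c ⁆
  ∈⁅⁆ {u} {c} u≡c = dec-true (u ≟ c) u≡c

  ⁅⁆-self : ∀ c → c ∈ ⁅ c ⁆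
  ⁅⁆-self c = dec-true (c ≟ c) refl

  ∉⁅⁆ : ∀ {u c} → u ≢ c → u ∉ ⁅ c ⁆
  ∉⁅⁆ {u} {c} u≢c = dec-false (u ≟ c) u≢c

  ∈⁅⁆⁻ : ∀ {u c} → u ∈ ⁅ c ⁆ → u ≡ c
  ∈⁅⁆⁻ {u} {c} h with u ≟ c | h
  ... | yes u≡c | _ = u≡c
  ... | no _    | ()

  ∩-elimˡ : ∀ {S P u} → u ∈ S ∩ P → u ∈ S
  ∩-elimˡ {S} {P} {u} = ∧-conicalˡ (S u) (P u)

  ∩-elimʳ : ∀ {S P u} → u ∈ S ∩ P → u ∈ P
  ∩-elimʳ {S} {P} {u} = ∧-conicalʳ (S u) (P u)

  ∪-introˡ : ∀ {S P u} → u ∈ S → u ∈ S ∪ P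
  ∪-introˡ {S} {P} {u} u∈S = cong (_∨ P u) u∈S

  ∪-introʳ : ∀ {S P u} → u ∈ P → u ∈ S ∪ P
  ∪-introʳ {S} {P} {u} = ∨-introʳ (S u)

  ∪-elim : ∀ {S P u} → u ∈ S ∪ P → u ∈ S ⊎ u ∈ P
  ∪-elim {S} {P} {u} = ∨-elim (S u)

  ∪-∉ : ∀ {S P u} → u ∉ S → u ∉ P → u ∉ S ∪ P
  ∪-∉ = ∨-false

  ∪-∉ˡ : ∀ {S P u} → u ∉ S ∪ P → u ∉ S
  ∪-∉ˡ {S} {P} {u} = ∨-conicalˡ (S u) (P u)

  ∖-intro : ∀ {S P u} → u ∈ S → u ∉ P → u ∈ S ∖ P
  ∖-intro u∈S u∉P = ∧-true u∈S (cong not u∉P)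

  ∖-⊆ : ∀ {S P} → S ∖ P ⊆ S
  ∖-⊆ {S} {P} u = ∧-conicalˡ (S u) (not (P u))

  ∖-elimʳ : ∀ {S P u} → u ∈ S ∖ P → u ∉ P
  ∖-elimʳ {S} {P} {u} h = not-true (∧-conicalʳ (S u) (not (P u)) h)

  ∖-∉ : ∀ {S P u} → u ∈ P → u ∉ S ∖ P
  ∖-∉ {S} {P} {u} u∈P = trans (cong (λ b → S u ∧ not b) u∈P) (∧-zeroʳ (S u))

  ∁-intro : ∀ {S u} → u ∉ S → u ∈ ∁ S
  ∁-intro = cong not

  ∁-elim : ∀ {S u} → u ∈ ∁ S → u ∉ S
  ∁-elim = not-true

  ∁-∉ : ∀ {S u} → u ∈ S → u ∉ ∁ S
  ∁-∉ = cong not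

  ∁-∉⁻ : ∀ {S u} → u ∉ ∁ S → u ∈ S
  ∁-∉⁻ = not-false

count-cong : ∀ {n} {S P : Subset n} → (∀ u → S u ≡ P u) → count S ≡ count P
count-cong {zero}  h = refl
count-cong {suc n} h rewrite h fzero = cong (_ +_) (count-cong (λ u → h (fsuc u)))

count-mono : ∀ {n} {S P : Subset n} → S ⊆ P → count S ≤ count P
count-mono {zero} _ = z≤n
count-mono {suc n} {S} {P} S⊆P with S fzero in s₀ | P fzero in p₀
... | true  | true  = s≤s (count-mono (λ u → S⊆P (fsuc u)))
... | true  | false = ⊥-elim (true≢false (trans (sym (S⊆P fzero s₀)) p₀))
... | false | true  = m≤n⇒m≤1+n (count-mono (λ u → S⊆P (fsuc u)))
... | false | false = count-mono (λ u → S⊆P (fsuc u))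

count-strict : ∀ {n} {S P : Subset n} (c : Fin n) → S ⊆ P → c ∉ S → c ∈ P → count S < count P
count-strict {suc n} {S} {P} fzero S⊆P c∉S c∈P rewrite c∉S | c∈P =
  s≤s (count-mono (λ u → S⊆P (fsuc u)))
count-strict {suc n} {S} {P} (fsuc c) S⊆P c∉S c∈P with S fzero in s₀ | P fzero in p₀
... | true  | true  = s≤s (count-strict c (λ u → S⊆P (fsuc u)) c∉S c∈P)
... | true  | false = ⊥-elim (true≢false (trans (sym (S⊆P fzero s₀)) p₀))
... | false | true  = m≤n⇒m≤1+n (count-strict c (λ u → S⊆P (fsuc u)) c∉S c∈P)
... | false | false = count-strict c (λ u → S⊆P (fsuc u)) c∉S c∈P

count-split : ∀ {n} (S P : Subset n) → count S ≡ count (S ∩ P) + count (S ∖ P)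
count-split {zero}  S P = refl
count-split {suc n} S P with S fzero | P fzero
... | true  | true  = cong suc (count-split (λ u → S (fsuc u)) (λ u → P (fsuc u)))
... | true  | false = trans (cong suc (count-split (λ u → S (fsuc u)) (λ u → P (fsuc u))))
                           (sym (+-suc _ _))
... | false | true  = count-split (λ u → S (fsuc u)) (λ u → P (fsuc u))
... | false | false = count-split (λ u → S (fsuc u)) (λ u → P (fsuc u))

count-witness : ∀ {n} {S : Subset n} → 0 < count S → ∃ λ u → u ∈ S
count-witness {suc n} {S} h with S fzero in s₀
... | true  = fzero , s₀
... | false with count-witness h
...   | u , u∈S = fsuc u , u∈S

count-none : ∀ {n} {S : Subset n} → (∀ u → ¬ u ∈ S) → count S ≡ 0
count-none {zero} _ = refl
count-none {suc n} {S} none with S fzero in s₀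
... | true  = ⊥-elim (none fzero s₀)
... | false = count-none (λ u → none (fsuc u))

indicator≤1 : ∀ b → (if b then 1 else 0) ≤ 1
indicator≤1 true  = s≤s z≤n
indicator≤1 false = z≤n

count-≤1 : ∀ {n} {S : Subset n} (c : Fin n) → (∀ u → u ∈ S → u ≡ c) → count S ≤ 1
count-≤1 {suc n} {S} fzero only-c = +-mono-≤ (indicator≤1 (S fzero)) (≤-reflexive rest-empty)
  where
  rest-empty : count (λ u → S (fsuc u)) ≡ 0
  rest-empty = count-none λ u u∈S → 0≢1+n (sym (only-c (fsuc u) u∈S))
count-≤1 {suc n} {S} (fsuc c) only-c with S fzero in s₀
... | true  = ⊥-elim (0≢1+n (only-c fzero s₀))
... | false = count-≤1 c (λ u u∈S → suc-injective (only-c (fsuc u) u∈S))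

weight : ∀ {n} → Subset n → Subset n → ℕ
weight m B = count (B ∩ m)

weight-split : ∀ {n} (m B P : Subset n) → weight m B ≡ weight m (B ∩ P) + weight m (B ∖ P)
weight-split m B P =
  trans (count-split (B ∩ m) P)
        (cong₂ _+_ (count-cong λ u → ∧-swapʳ (B u) (m u) (P u))
                   (count-cong λ u → ∧-swapʳ (B u) (m u) (not (P u))))

weight-∩-⊆ : ∀ {n} (m : Subset n) {B S : Subset n} → S ⊆ B → weight m (B ∩ S) ≡ weight m S
weight-∩-⊆ m {B} {S} S⊆B = count-cong λ u → cong (_∧ m u) (∧-absorb (B u) (S u) (S⊆B u))

weight-remove : ∀ {n} (m B : Subset n) (c : Fin n) → weight m B ≤ suc (weight m (B ∖ ⁅ c ⁆))
weight-remove m B c = begin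
  weight m B                                           ≡⟨ weight-split m B ⁅ c ⁆ ⟩
  weight m (B ∩ ⁅ c ⁆) + weight m (B ∖ ⁅ c ⁆)          ≤⟨ +-monoˡ-≤ _ at-most-c ⟩
  suc (weight m (B ∖ ⁅ c ⁆))                           ∎
  where
  open ≤-Reasoning
  at-most-c : weight m (B ∩ ⁅ c ⁆) ≤ 1
  at-most-c = count-≤1 {S = B ∩ ⁅ c ⁆ ∩ m} c λ u h →
    ∈⁅⁆⁻ (∩-elimʳ {S = B} {P = ⁅ c ⁆} (∩-elimˡ {S = B ∩ ⁅ c ⁆} {P = m} h))

μ-total : ∀ {n} (G : Graph n) (m : Subset n) → (∀ u → V G u ≡ true) → μ G m ≡ count m
μ-total G m allV = count-cong λ u → cong (_∧ m u) (allV u)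

twice : ∀ r → 2 * r ≡ r + r
twice r = cong (r +_) (+-identityʳ r)

half-split : ∀ r a b → 2 * r ≤ a + b → r ≤ a ⊎ r ≤ b
half-split r a b h with r ≤? a | r ≤? b
... | yes r≤a | _       = inj₁ r≤a
... | no _    | yes r≤b = inj₂ r≤b
... | no r≰a  | no r≰b  =
  ⊥-elim (<⇒≱ (+-mono-< (≰⇒> r≰a) (≰⇒> r≰b)) (subst (_≤ a + b) (twice r) h))

half-lower : ∀ r c → 2 * r ≤ suc c → r ≤ c
half-lower r c h with r ≤? c
... | yes r≤c = r≤c
... | no r≰c  = ≤-trans (+-cancelˡ-≤ r r 0 r+r≤r+0) z≤n
  where
  r+r≤r+0 : r + r ≤ r + 0
  r+r≤r+0 = ≤-trans (subst (_≤ suc c) (twice r) h)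
                    (≤-trans (≰⇒> r≰c) (≤-reflexive (sym (+-identityʳ r))))

module _ {n : ℕ} {G : Graph n} where

  edge-sym : ∀ {x y} → E G x y ≡ true → E G y x ≡ true
  edge-sym {x} {y} e = trans (Esym G y x) e

  walk-++ : ∀ {x y z} → Walk G x y → Walk G y z → Walk G x z
  walk-++ (here _)   q = q
  walk-++ (step e p) q = step e (walk-++ p q)

  walk-reverse : ∀ {x y} → Walk G x y → Walk G y x
  walk-reverse (here x∈G) = here x∈G
  walk-reverse (step {x} {y} e p) =
    walk-++ (walk-reverse p) (step (edge-sym e) (here (EV G x y e)))

induced : ∀ {n} → Graph n → Subset n → Graph n
induced G S = record
  { V    = S
  ; E    = λ x y → E G x y ∧ (S x ∧ S y)
  ; Esym = λ x y → cong₂ _∧_ (Esym G x y) (∧-comm (S x) (S y))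
  ; Eirr = λ u → cong (_∧ (S u ∧ S u)) (Eirr G u)
  ; EV   = λ x y h → ∧-conicalˡ (S x) (S y) (∧-conicalʳ (E G x y) _ h)
  }

module _ {n : ℕ} (G : Graph n) (S : Subset n) {x y : Fin n} where

  induced-edge : E G x y ≡ true → x ∈ S → y ∈ S → E (induced G S) x y ≡ true
  induced-edge e x∈S y∈S = ∧-true e (∧-true x∈S y∈S)

  induced-edge-∉ˡ : x ∉ S → E (induced G S) x y ≡ false
  induced-edge-∉ˡ x∉S = trans (cong (λ b → E G x y ∧ (b ∧ S y)) x∉S) (∧-zeroʳ (E G x y))

  induced-edge-∉ʳ : y ∉ S → E (induced G S) x y ≡ false
  induced-edge-∉ʳ y∉S =
    trans (cong (λ b → E G x y ∧ (S x ∧ b)) y∉S)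
          (trans (cong (E G x y ∧_) (∧-zeroʳ (S x))) (∧-zeroʳ (E G x y)))

induced-cycle : ∀ {n} {G : Graph n} {S : Subset n} → HasCycle (induced G S) → HasCycle G
induced-cycle {G = G} {S} (x , xs , unique , long , chain) =
  x , xs , unique , long , lift (x ∷ xs ++ [ x ]) chain
  where
  lift : ∀ l → Chain (induced G S) l → Chain G l
  lift []           _       = tt
  lift (a ∷ [])     _       = tt
  lift (a ∷ b ∷ l) (e , c) = ∧-conicalˡ (E G a b) _ e , lift (b ∷ l) c

-- Branches of a graph, and the two sides they determine

module _ {n : ℕ} (G : Graph n) where

  HangsAt : Subset n → Fin n → Set
  HangsAt B w = ∀ x z → x ∈ B → E G x z ≡ true → z ∈ B ⊎ z ≡ w

  SealedAt : Subset n → Fin n → Set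
  SealedAt S w = ∀ x z → x ∈ S → x ≢ w → E G x z ≡ true → z ∈ S

-- The two sides of a set B hanging at w in G: the near side B ∪ {w} and the far side ∁ B.
module Sides {n : ℕ} (G : Graph n) (B : Subset n) (w : Fin n) where

  exit-edge : HangsAt G B w → ∀ {x y} → Walk G x y → x ∈ B → y ∉ B →
              ∃ λ c → c ∈ B × E G c w ≡ true
  exit-edge hangs (here _) x∈B x∉B = ⊥-elim (∈∉ {S = B} x∈B x∉B)
  exit-edge hangs {x} (step {w = z} e p) x∈B y∉B with hangs x z x∈B e
  ... | inj₁ z∈B = exit-edge hangs p z∈B y∉B
  ... | inj₂ refl = x , x∈B , e

  to-near : ∀ {x} → x ∈ B → x ∈ B ∪ ⁅ w ⁆
  to-near = ∪-introˡ {S = B} {P = ⁅ w ⁆}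

  hangs-near : HangsAt G B w → ∀ {x z} → x ∈ B → E G x z ≡ true → z ∈ B ∪ ⁅ w ⁆
  hangs-near hangs {x} {z} x∈B e with hangs x z x∈B e
  ... | inj₁ z∈B = to-near z∈B
  ... | inj₂ z≡w = ∪-introʳ {S = B} {P = ⁅ w ⁆} (∈⁅⁆ z≡w)

  near-sealed : HangsAt G B w → SealedAt G (B ∪ ⁅ w ⁆) w
  near-sealed hangs x z x∈near x≢w e with ∪-elim {S = B} {P = ⁅ w ⁆} x∈near
  ... | inj₁ x∈B  = hangs-near hangs x∈B e
  ... | inj₂ x∈⁅w⁆ = ⊥-elim (x≢w (∈⁅⁆⁻ x∈⁅w⁆))

  far-sealed : HangsAt G B w → SealedAt G (∁ B) w
  far-sealed hangs x z x∈far x≢w e with ∈-or-∉ B z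
  ... | inj₂ z∉B = ∁-intro {S = B} z∉B
  ... | inj₁ z∈B with hangs z x z∈B (edge-sym {G = G} e)
  ...   | inj₁ x∈B = ⊥-elim (∈∉ {S = B} x∈B (∁-elim {S = B} x∈far))
  ...   | inj₂ x≡w = ⊥-elim (x≢w x≡w)

  outside-edge : ∀ {x y} → x ∉ B → y ∉ B → E G x y ≡ true →
                 E (induced G (B ∪ ⁅ w ⁆)) x y ≡ false
  outside-edge {x} {y} x∉B y∉B e with ∈-or-∉ ⁅ w ⁆ x
  ... | inj₂ x∉⁅w⁆ = induced-edge-∉ˡ G (B ∪ ⁅ w ⁆) (∪-∉ {S = B} {P = ⁅ w ⁆} x∉B x∉⁅w⁆)
  ... | inj₁ x∈⁅w⁆ = induced-edge-∉ʳ G (B ∪ ⁅ w ⁆) (∪-∉ {S = B} {P = ⁅ w ⁆} y∉B (∉⁅⁆ y≢w))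
    where
    y≢w : y ≢ w
    y≢w refl = true≢false (trans (sym loop) (Eirr G y))
      where
      loop : E G y y ≡ true
      loop = subst (λ t → E G t y ≡ true) (∈⁅⁆⁻ x∈⁅w⁆) e

  branch-edges : w ∉ B → HangsAt G B w → ∀ x y → E G x y ≡ true →
    (E (induced G (B ∪ ⁅ w ⁆)) x y ≡ true × E (induced G (∁ B)) x y ≡ false) ⊎
    (E (induced G (B ∪ ⁅ w ⁆)) x y ≡ false × E (induced G (∁ B)) x y ≡ true)
  branch-edges w∉B hangs x y e with ∈-or-∉ B x | ∈-or-∉ B y
  ... | inj₁ x∈B | _ =
    inj₁ (induced-edge G (B ∪ ⁅ w ⁆) e (to-near x∈B) (hangs-near hangs x∈B e) ,
          induced-edge-∉ˡ G (∁ B) (∁-∉ {S = B} x∈B))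
  ... | inj₂ _ | inj₁ y∈B =
    inj₁ (induced-edge G (B ∪ ⁅ w ⁆) e (hangs-near hangs y∈B (edge-sym {G = G} e)) (to-near y∈B) ,
          induced-edge-∉ʳ G (∁ B) (∁-∉ {S = B} y∈B))
  ... | inj₂ x∉B | inj₂ y∉B =
    inj₂ (outside-edge x∉B y∉B e ,
          induced-edge G (∁ B) e (∁-intro {S = B} x∉B) (∁-intro {S = B} y∉B))

-- Trees: induced subtrees and components with simple paths

module InTree {n : ℕ} (T : Graph n) (allV : ∀ u → V T u ≡ true) (tree : IsTree T) where

  walk : ∀ x y → Walk T x y
  walk x y = proj₁ (proj₂ tree) x y (allV x) (allV y)

  acyclic : ¬ HasCycle T
  acyclic = proj₂ (proj₂ tree)

  restrict-walk : ∀ {S w x y} → SealedAt T S w → x ∈ S → Walk T x y →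
                  Walk (induced T S) x y ⊎ Walk (induced T S) x w
  restrict-walk sealed x∈S (here _) = inj₁ (here x∈S)
  restrict-walk {S} {w} {x} sealed x∈S (step {w = z} e p) with x ≟ w
  ... | yes refl = inj₂ (here x∈S)
  ... | no x≢w  = Sum.map (step e′) (step e′) (restrict-walk sealed z∈S p)
    where
    z∈S : z ∈ S
    z∈S = sealed x z x∈S x≢w e
    e′ : E (induced T S) x z ≡ true
    e′ = induced-edge T S e x∈S z∈S

  -- Hence a sealed set is connected: join x and y directly, or both through w.
  induced-connected : ∀ {S w x y} → SealedAt T S w → x ∈ S → y ∈ S → Walk (induced T S) x y
  induced-connected {x = x} {y} sealed x∈S y∈S
    with restrict-walk sealed x∈S (walk x y) | restrict-walk sealed y∈S (walk y x)
  ... | inj₁ x⇝y | _        = x⇝y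
  ... | inj₂ _   | inj₁ y⇝x = walk-reverse y⇝x
  ... | inj₂ x⇝w | inj₂ y⇝w = walk-++ x⇝w (walk-reverse y⇝w)

  induced-subtree : ∀ {S w} → w ∈ S → SealedAt T S w → IsSubtree (induced T S) T
  induced-subtree {S} {w} w∈S sealed =
    ((w , w∈S) , (λ x y → induced-connected sealed) , (λ cycle → acyclic (induced-cycle cycle))) ,
    (λ u _ → allV u) , (λ x y → ∧-conicalˡ (E T x y) _)

  -- PathTo c x t: the list x ∷ t traces a walk in T from x to c.
  data PathTo (c : Fin n) : Fin n → List (Fin n) → Set where
    start  : PathTo c c []
    extend : ∀ {x y t} → PathTo c x t → E T y x ≡ true → PathTo c y (x ∷ t)

  path-chain : ∀ {c w x t} → PathTo c x t → E T c w ≡ true → Chain T (x ∷ t ++ [ w ])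
  path-chain start          e = e , tt
  path-chain (extend p e′) e = e′ , path-chain p e

  path-nonempty : ∀ {c x t} → PathTo c x t → x ≢ c → 1 ≤ length t
  path-nonempty start      x≢c = ⊥-elim (x≢c refl)
  path-nonempty (extend _ _) _ = s≤s z≤n

  SimplePathIn : Fin n → Subset n → Fin n → Set
  SimplePathIn c S x = Σ (List (Fin n)) λ t → PathTo c x t × Unique (x ∷ t) × All (_∈ S) (x ∷ t)

  -- A vertex w outside S touches S only at c, if all of S is joined to c inside S:
  -- a second contact x would close the cycle w, x, …, c, w.
  unique-contact : ∀ {S c w x} → w ∉ S → SimplePathIn c S x →
                   E T c w ≡ true → E T x w ≡ true → x ≡ c
  unique-contact {S} {c} {w} {x} w∉S (t , path , unique , inside) c~w x~w with x ≟ c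
  ... | yes x≡c = x≡c
  ... | no x≢c  = ⊥-elim (acyclic
          (w , x ∷ t , All.map (∉-distinct {S = S} w∉S) inside ∷ unique ,
           s≤s (path-nonempty path x≢c) , edge-sym {G = T} x~w , path-chain path c~w))

  -- The component of c inside B, grown one boundary edge at a time.
  module Component (B : Subset n) (c : Fin n) where

    record Grown (S : Subset n) : Set where
      field
        within : S ⊆ B
        centre : c ∈ S
        paths  : ∀ x → x ∈ S → SimplePathIn c S x

    ClosedIn : Subset n → Set
    ClosedIn S = ∀ x y → x ∈ S → y ∈ B → E T x y ≡ true → y ∈ S

    record Closure : Set where
      field
        S      : Subset n
        grown  : Grown S
        closed : ClosedIn S

    Boundary : Subset n → Set
    Boundary S = ∃ λ x → ∃ λ y → x ∈ S × y ∈ B × y ∉ S × E T x y ≡ true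

    boundary? : ∀ S → Dec (Boundary S)
    boundary? S = any? λ x → any? λ y →
      (S x ≟ᵇ true) ×-dec (B y ≟ᵇ true) ×-dec (S y ≟ᵇ false) ×-dec (E T x y ≟ᵇ true)

    -- Adding the far end y of a boundary edge x–y: y's path is y followed by x's path.
    grow-step : ∀ {S x y} → Grown S → x ∈ S → y ∈ B → y ∉ S → E T x y ≡ true →
                Grown (S ∪ ⁅ y ⁆)
    grow-step {S} {x} {y} g x∈S y∈B y∉S x~y = record
      { within = within′ ; centre = ∪-introˡ {S = S} {P = ⁅ y ⁆} centre ; paths = paths′ }
      where
      open Grown g
      into : ∀ {u} → u ∈ S → u ∈ S ∪ ⁅ y ⁆
      into = ∪-introˡ {S = S} {P = ⁅ y ⁆}
      within′ : S ∪ ⁅ y ⁆ ⊆ B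
      within′ u u∈S′ with ∪-elim {S = S} {P = ⁅ y ⁆} u∈S′
      ... | inj₁ u∈S  = within u u∈S
      ... | inj₂ u∈⁅y⁆ = subst (_∈ B) (sym (∈⁅⁆⁻ u∈⁅y⁆)) y∈B
      paths′ : ∀ u → u ∈ S ∪ ⁅ y ⁆ → SimplePathIn c (S ∪ ⁅ y ⁆) u
      paths′ u u∈S′ with ∪-elim {S = S} {P = ⁅ y ⁆} u∈S′
      ... | inj₁ u∈S with paths u u∈S
      ...   | t , path , unique , inside = t , path , unique , All.map into inside
      paths′ u u∈S′ | inj₂ u∈⁅y⁆ with ∈⁅⁆⁻ {u = u} {c = y} u∈⁅y⁆ | paths x x∈S
      ...   | refl | t , path , unique , inside =
              x ∷ t , extend path (edge-sym {G = T} x~y) ,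
              All.map (∉-distinct {S = S} y∉S) inside ∷ unique ,
              ∪-introʳ {S = S} {P = ⁅ y ⁆} (⁅⁆-self y) ∷ All.map into inside

    grow-shrinks : ∀ {S y} → y ∈ B → y ∉ S → count (B ∖ (S ∪ ⁅ y ⁆)) < count (B ∖ S)
    grow-shrinks {S} {y} y∈B y∉S =
      count-strict y fewer (∖-∉ {S = B} {P = S ∪ ⁅ y ⁆} (∪-introʳ {S = S} {P = ⁅ y ⁆} (⁅⁆-self y)))
                   (∖-intro {S = B} {P = S} y∈B y∉S)
      where
      fewer : B ∖ (S ∪ ⁅ y ⁆) ⊆ B ∖ S
      fewer u h = ∖-intro {S = B} {P = S} (∖-⊆ {S = B} {P = S ∪ ⁅ y ⁆} u h)
                          (∪-∉ˡ {S = S} {P = ⁅ y ⁆} (∖-elimʳ {S = B} {P = S ∪ ⁅ y ⁆} h))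

    -- Grow S until no boundary edge is left; the fuel bounds the vertices still to add.
    grow : ∀ k S → Grown S → count (B ∖ S) < k → Closure
    grow zero S g ()
    grow (suc k) S g fuel with boundary? S
    ... | no none = record { S = S ; grown = g ; closed = closed }
      where
      closed : ClosedIn S
      closed x y x∈S y∈B x~y with ∈-or-∉ S y
      ... | inj₁ y∈S = y∈S
      ... | inj₂ y∉S = ⊥-elim (none (x , y , x∈S , y∈B , y∉S , x~y))
    ... | yes (x , y , x∈S , y∈B , y∉S , x~y) =
      grow k (S ∪ ⁅ y ⁆) (grow-step g x∈S y∈B y∉S x~y)
           (<-≤-trans (grow-shrinks y∈B y∉S) (≤-pred fuel))

    component : c ∈ B → Closure
    component c∈B = grow (suc (count (B ∖ ⁅ c ⁆))) ⁅ c ⁆ seed (n<1+n _)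
      where
      seed : Grown ⁅ c ⁆
      seed = record
        { within = λ u u∈⁅c⁆ → subst (_∈ B) (sym (∈⁅⁆⁻ u∈⁅c⁆)) c∈B
        ; centre = ⁅⁆-self c
        ; paths  = λ u u∈⁅c⁆ → trivial u (∈⁅⁆⁻ u∈⁅c⁆) }
        where
        trivial : ∀ u → u ≡ c → SimplePathIn c ⁅ c ⁆ u
        trivial u refl = [] , start , [] ∷ [] , ⁅⁆-self c ∷ []

  module Rooted (v : Fin n) where

    record Branch (w : Fin n) (B : Subset n) : Set where
      field
        w∉B   : w ∉ B
        v∉B   : v ∉ B
        hangs : HangsAt T B w

    record Split (w : Fin n) (B : Subset n) : Set where
      field
        c             : Fin n
        inner outer   : Subset n
        inner-branch  : Branch c inner
        outer-branch  : Branch w outer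
        inner-smaller : count inner < count B
        outer-smaller : count outer < count B
        weight-bound  : ∀ m → weight m B ≤ suc (weight m inner + weight m outer)

    split : ∀ {w B c} → Branch w B → c ∈ B → E T c w ≡ true → Split w B
    split {w} {B} {c} br c∈B c~w = record
      { c = c ; inner = S ∖ ⁅ c ⁆ ; outer = B ∖ S
      ; inner-branch  = record { w∉B = ∖-∉ {S = S} {P = ⁅ c ⁆} (⁅⁆-self c)
                               ; v∉B = ∉-⊆ inner⊆B v∉B ; hangs = inner-hangs }
      ; outer-branch  = record { w∉B = ∉-⊆ outer⊆B w∉B ; v∉B = ∉-⊆ outer⊆B v∉B
                               ; hangs = outer-hangs }
      ; inner-smaller = count-strict c inner⊆B (∖-∉ {S = S} {P = ⁅ c ⁆} (⁅⁆-self c)) c∈B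
      ; outer-smaller = count-strict c outer⊆B (∖-∉ {S = B} {P = S} centre) c∈B
      ; weight-bound  = bound }
      where
      open Branch br
      open Component B c
      open Closure (component c∈B)
      open Grown grown

      inner⊆B : S ∖ ⁅ c ⁆ ⊆ B
      inner⊆B u h = within u (∖-⊆ {S = S} {P = ⁅ c ⁆} u h)
      outer⊆B : B ∖ S ⊆ B
      outer⊆B = ∖-⊆ {S = B} {P = S}

      inner-hangs : HangsAt T (S ∖ ⁅ c ⁆) c
      inner-hangs x z x∈ x~z with hangs x z (inner⊆B x x∈) x~z
      ... | inj₂ refl = ⊥-elim (∈∉ {S = ⁅ c ⁆} {u = x} (∈⁅⁆ x≡c) (∖-elimʳ {S = S} {P = ⁅ c ⁆} x∈))
        where
        x≡c : x ≡ c
        x≡c = unique-contact (∉-⊆ within w∉B) (paths x (∖-⊆ {S = S} {P = ⁅ c ⁆} x x∈)) c~w x~z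
      ... | inj₁ z∈B with ∈-or-∉ ⁅ c ⁆ z
      ...   | inj₁ z∈⁅c⁆ = inj₂ (∈⁅⁆⁻ z∈⁅c⁆)
      ...   | inj₂ z∉⁅c⁆ = inj₁ (∖-intro {S = S} {P = ⁅ c ⁆}
                                 (closed x z (∖-⊆ {S = S} {P = ⁅ c ⁆} x x∈) z∈B x~z) z∉⁅c⁆)

      outer-hangs : HangsAt T (B ∖ S) w
      outer-hangs x z x∈ x~z with hangs x z (outer⊆B x x∈) x~z
      ... | inj₂ z≡w = inj₂ z≡w
      ... | inj₁ z∈B with ∈-or-∉ S z
      ...   | inj₂ z∉S = inj₁ (∖-intro {S = B} {P = S} z∈B z∉S)
      ...   | inj₁ z∈S = ⊥-elim (∈∉ {S = S} (closed z x z∈S (outer⊆B x x∈) (edge-sym {G = T} x~z))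
                                            (∖-elimʳ {S = B} {P = S} x∈))

      bound : ∀ m → weight m B ≤ suc (weight m (S ∖ ⁅ c ⁆) + weight m (B ∖ S))
      bound m = begin
        weight m B
          ≡⟨ weight-split m B S ⟩
        weight m (B ∩ S) + weight m (B ∖ S)
          ≡⟨ cong (_+ weight m (B ∖ S)) (weight-∩-⊆ m within) ⟩
        weight m S + weight m (B ∖ S)
          ≤⟨ +-monoˡ-≤ _ (weight-remove m S c) ⟩
        suc (weight m (S ∖ ⁅ c ⁆) + weight m (B ∖ S))
          ∎
        where open ≤-Reasoning

    -- A nonempty branch at w contains a neighbour of w: a walk from it to v must leave it.
    contact : ∀ {w B u} → Branch w B → u ∈ B → ∃ λ c → c ∈ B × E T c w ≡ true
    contact {w} {B} {u} br u∈B = exit-edge hangs (walk u v) u∈B v∉B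
      where
      open Branch br
      open Sides T B w

    -- A branch of weight between r and 2r yields an r-good partition: T₁ is
    -- induced on B ∪ {w} with w unmarked, T₂ on the complement of B.
    branch-partition : ∀ {w B} (m : Subset n) (r : ℕ) → Branch w B →
                       r ≤ weight m B → weight m B ≤ 2 * r → GoodPartition T m r v
    branch-partition {w} {B} m r br lower upper = record
      { T₁ = induced T near ; T₂ = induced T (∁ B) ; m₁ = m ∖ ⁅ w ⁆ ; m₂ = m
      ; sub₁  = induced-subtree w∈near (near-sealed hangs)
      ; sub₂  = induced-subtree (∁-intro {S = B} w∉B) (far-sealed hangs)
      ; edges = branch-edges w∉B hangs
      ; lower = subst (r ≤_) (sym near-weight) lower
      ; upper = subst (_≤ 2 * r) (sym near-weight) upper
      ; root  = ∁-intro {S = B} v∉B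
      ; cover = λ u _ → cover u
      ; both  = both
      ; only₁ = only₁
      ; only₂ = λ _ _ _ → refl }
      where
      open Branch br
      open Sides T B w
      near : Subset n
      near = B ∪ ⁅ w ⁆

      w∈near : w ∈ near
      w∈near = ∪-introʳ {S = B} {P = ⁅ w ⁆} {u = w} (⁅⁆-self w)

      near-weight : μ (induced T near) (m ∖ ⁅ w ⁆) ≡ weight m B
      near-weight = count-cong λ u →
        ∪-unmark (B u) (⁅ w ⁆ u) (m u) (λ u∈⁅w⁆ → subst (_∉ B) (sym (∈⁅⁆⁻ u∈⁅w⁆)) w∉B)

      cover : ∀ u → u ∈ near ⊎ u ∈ ∁ B
      cover u with ∈-or-∉ B u
      ... | inj₁ u∈B = inj₁ (∪-introˡ {S = B} {P = ⁅ w ⁆} u∈B)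
      ... | inj₂ u∉B = inj₂ (∁-intro {S = B} u∉B)

      -- only w lies on both sides
      both : ∀ u → u ∈ near → u ∈ ∁ B → m u ≡ ((m ∖ ⁅ w ⁆) u xor m u)
      both u u∈near u∈far with ∪-elim {S = B} {P = ⁅ w ⁆} u∈near
      ... | inj₁ u∈B   = ⊥-elim (∈∉ {S = B} u∈B (∁-elim {S = B} u∈far))
      ... | inj₂ u∈⁅w⁆ = mark-split (m u) u∈⁅w⁆

      only₁ : ∀ u → u ∈ near → u ∉ ∁ B → m u ≡ (m ∖ ⁅ w ⁆) u
      only₁ u _ u∉far =
        mark-kept (m u) (∉⁅⁆ (λ u≡w → ∉-distinct {S = B} w∉B (∁-∉⁻ {S = B} u∉far) (sym u≡w)))

    initial-branch : Branch v (∁ ⁅ v ⁆)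
    initial-branch = record { w∉B = v∉ ; v∉B = v∉ ; hangs = hangs }
      where
      v∉ : v ∉ ∁ ⁅ v ⁆
      v∉ = ∁-∉ {S = ⁅ v ⁆} {u = v} (⁅⁆-self v)
      hangs : HangsAt T (∁ ⁅ v ⁆) v
      hangs x z _ _ with ∈-or-∉ ⁅ v ⁆ z
      ... | inj₁ z∈⁅v⁆ = inj₂ (∈⁅⁆⁻ z∈⁅v⁆)
      ... | inj₂ z∉⁅v⁆ = inj₁ (∁-intro {S = ⁅ v ⁆} {u = z} z∉⁅v⁆)

    module Marked (m : Subset n) (r : ℕ) where

      record Balanced : Set where
        field
          w      : Fin n
          B      : Subset n
          branch : Branch w B
          lower  : r ≤ weight m B
          upper  : weight m B ≤ 2 * r

      Smaller : Subset n → Set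
      Smaller B = Σ (Fin n) λ w′ → Σ (Subset n) λ B′ →
                  Branch w′ B′ × r ≤ weight m B′ × count B′ < count B

      heavier-part : ∀ {w B} → 2 * r < weight m B → Split w B → Smaller B
      heavier-part {w} {B} heavy sp =
        choose (half-split r (weight m inner) (weight m outer)
                           (≤-pred (≤-trans heavy (weight-bound m))))
        where
        open Split sp
        choose : r ≤ weight m inner ⊎ r ≤ weight m outer → Smaller B
        choose (inj₁ r≤inner) = c , inner , inner-branch , r≤inner , inner-smaller
        choose (inj₂ r≤outer) = w , outer , outer-branch , r≤outer , outer-smaller

      shrink : ∀ {w B} → Branch w B → 2 * r < weight m B → Smaller B
      shrink {B = B} br heavy =
        let u , u∈B∩m     = count-witness {S = B ∩ m} (≤-trans (s≤s z≤n) heavy)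
            c , c∈B , c~w = contact br (∩-elimˡ {S = B} {P = m} u∈B∩m)
        in  heavier-part heavy (split br c∈B c~w)

      -- Shrink until the weight is at most 2r; the fuel bounds the number of vertices.
      descend : ∀ k w B → Branch w B → r ≤ weight m B → count B < k → Balanced
      descend zero _ _ _ _ ()
      descend (suc k) w B br lower fuel with weight m B ≤? 2 * r
      ... | yes upper = record { w = w ; B = B ; branch = br ; lower = lower ; upper = upper }
      ... | no heavy with shrink br (≰⇒> heavy)
      ...   | w′ , B′ , br′ , lower′ , smaller =
              descend k w′ B′ br′ lower′ (<-≤-trans smaller (≤-pred fuel))

      initial-weight : 2 * r ≤ μ T m → r ≤ weight m (∁ ⁅ v ⁆)
      initial-weight heavy = half-lower r _ (begin
        2 * r                           ≤⟨ heavy ⟩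
        μ T m                           ≡⟨ μ-total T m allV ⟩
        weight m (λ _ → true)           ≤⟨ weight-remove m (λ _ → true) v ⟩
        suc (weight m (∁ ⁅ v ⁆))        ∎)
        where open ≤-Reasoning

-- The theorem: descend from the initial branch and read off the partition.
lemma1 : (n r : ℕ) → 0 < r →
    (T : Graph n) → (∀ u → V T u ≡ true) → IsTree T →
    (m : Fin n → Bool) → 2 * r ≤ μ T m →
    (v : Fin n) → GoodPartition T m r v
lemma1 n r _ T allV tree m heavy v = branch-partition m r branch lower upper
  where
  open InTree T allV tree
  open Rooted v
  open Marked m r
  open Balanced (descend (suc (count (∁ ⁅ v ⁆))) v (∁ ⁅ v ⁆) initial-branch
                         (initial-weight heavy) (n<1+n _))
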